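{- Let $\mathcal{R}'=\{\beta,\mu,\mu',\rho,\varepsilon\}$, let $M\in\mathcal{WN}_{\mathcal{R}'}\cap\mathcal{T}_t$ and let $\alpha$ be a $\mu$-variable. If $\mu\alpha.M\in\mathcal{T}_t$, then $\mu\alpha.M\in\mathcal{WN}_{\mathcal{R}'}\cap\mathcal{T}_t$.
   Context: $\lambda\mu$-terms: $\mathcal{T} ::= x \mid \lambda x.\mathcal{T} \mid (\mathcal{T})\mathcal{T} \mid [\alpha]\mathcal{T} \mid \mu\alpha.\mathcal{T}$, up to renaming of bound variables; substitutions avoid capture. Types $A ::= X \mid \bot \mid A\to B$; typing judgments $\Gamma\vdash M:A;\Theta$ by: $\Gamma,x:A\vdash x:A;\Theta$; from $\Gamma,x:A\vdash M:B;\Theta$ infer $\Gamma\vdash\lambda x.M:A\to B;\Theta$; from $\Gamma\vdash M:A\to B;\Theta$, $\Gamma\vdash N:A;\Theta$ infer $\Gamma\vdash(M)N:B;\Theta$; from $\Gamma\vdash M:A;\alpha:A,\Theta$ infer $\Gamma\vdash[\alpha]M:\bot;\alpha:A,\Theta$; from $\Gamma\vdash M:\bot;\alpha:A,\Theta$ infer $\Gamma\vdash\mu\alpha.M:A;\Theta$. $\mathcal{T}_t$ = typable terms. $M[\alpha:=\beta]$ renaming; $M[\alpha:=_rN]$ (resp. $M[\alpha:=_lN]$) replaces inductively each $[\alpha]P$ by $[\alpha](P')N$ (resp. $[\alpha](N)P'$); $M_\alpha$ replaces inductively each $[\alpha]P$ by $P$. Rules: $\beta$: $(\lambda x.M)N\to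 M[x:=N]$; $\mu$: $(\mu\alpha.M)N\to\mu\alpha.M[\alpha:=_rN]$; $\mu'$: $(N)\mu\alpha.M\to\mu\alpha.M[\alpha:=_lN]$; $\rho$: $[\beta]\mu\alpha.M\to M[\alpha:=\beta]$; $\varepsilon$: $\mu\alpha.\mu\beta.M\to\mu\alpha.M_\beta$. $\mathcal{WN}_{\mathcal{R}'}$: terms reducing (one redex contracted per step, anywhere) to a term with no $\mathcal{R}'$-redex. -}

module Defs where

-- λμ-calculus (Parigot), with de Bruijn indices for both sorts of variables
-- (λ-variables and μ-variables live in separate index spaces).
-- This realises "terms up to renaming of bound variables" and
-- capture-avoiding substitution.

open import Data.Nat using (ℕ; zero; suc; pred; _≟_)
open import Data.Product using (Σ; ∃; _×_; _,_)
open import Relation.Nullary using (¬_; yes; no)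
open import Relation.Binary.PropositionalEquality using (_≡_)
open import Relation.Binary.Construct.Closure.ReflexiveTransitive using (Star)

data Term : Set where
  var  : ℕ → Term
  lam  : Term → Term
  app  : Term → Term → Term
  name : ℕ → Term → Term     -- [α]M   (α a μ-variable index)
  mu   : Term → Term         -- μα.M   (binds μ-index 0 in M)

ext : (ℕ → ℕ) → ℕ → ℕ
ext ρ zero    = zero
ext ρ (suc n) = suc (ρ n)

renL : (ℕ → ℕ) → Term → Term
renL ρ (var x)    = var (ρ x)
renL ρ (lam M)    = lam (renL (ext ρ) M)
renL ρ (app M N)  = app (renL ρ M) (renL ρ N)
renL ρ (name α M) = name α (renL ρ M)
renL ρ (mu M)     = mu (renL ρ M)

renM : (ℕ → ℕ) → Term → Term
renM ρ (var x)    = var x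
renM ρ (lam M)    = lam (renM ρ M)
renM ρ (app M N)  = app (renM ρ M) (renM ρ N)
renM ρ (name α M) = name (ρ α) (renM ρ M)
renM ρ (mu M)     = mu (renM (ext ρ) M)

extsL : (ℕ → Term) → ℕ → Term
extsL σ zero    = var zero
extsL σ (suc n) = renL suc (σ n)

subL : (ℕ → Term) → Term → Term
subL σ (var x)    = σ x
subL σ (lam M)    = lam (subL (extsL σ) M)
subL σ (app M N)  = app (subL σ M) (subL σ N)
subL σ (name α M) = name α (subL σ M)
subL σ (mu M)     = mu (subL (λ n → renM suc (σ n)) M)

sub0 : Term → ℕ → Term
sub0 N zero    = N
sub0 N (suc n) = var n

_[0:=_] : Term → Term → Term
M [0:= N ] = subL (sub0 N) M

-- M[α:=_r N] with α = μ-index k: each [α]P becomes [α](P')N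
structR : ℕ → Term → Term → Term
structR k N (var x)    = var x
structR k N (lam M)    = lam (structR k (renL suc N) M)
structR k N (app M P)  = app (structR k N M) (structR k N P)
structR k N (name β M) with β ≟ k
... | yes _ = name β (app (structR k N M) N)
... | no  _ = name β (structR k N M)
structR k N (mu M)     = mu (structR (suc k) (renM suc N) M)

-- M[α:=_l N] with α = μ-index k: each [α]P becomes [α](N)P'
structL : ℕ → Term → Term → Term
structL k N (var x)    = var x
structL k N (lam M)    = lam (structL k (renL suc N) M)
structL k N (app M P)  = app (structL k N M) (structL k N P)
structL k N (name β M) with β ≟ k
... | yes _ = name β (app N (structL k N M))
... | no  _ = name β (structL k N M)
structL k N (mu M)     = mu (structL (suc k) (renM suc N) M)

erase : ℕ → Term → Term
erase k (var x)    = var x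
erase k (lam M)    = lam (erase k M)
erase k (app M P)  = app (erase k M) (erase k P)
erase k (name β M) with β ≟ k
... | yes _ = erase k M
... | no  _ = name β (erase k M)
erase k (mu M)     = mu (erase (suc k) M)

rhoRen : ℕ → ℕ → ℕ
rhoRen β zero    = β
rhoRen β (suc n) = n

infix 4 _⟶_
data _⟶_ : Term → Term → Set where
  β-red  : ∀ {M N} → app (lam M) N ⟶ M [0:= N ]
  μ-red  : ∀ {M N} → app (mu M) N ⟶ mu (structR 0 (renM suc N) M)
  μ'-red : ∀ {M N} → app N (mu M) ⟶ mu (structL 0 (renM suc N) M)
  ρ-red  : ∀ {β M} → name β (mu M) ⟶ renM (rhoRen β) M
  ε-red  : ∀ {M}   → mu (mu M) ⟶ mu (renM pred (erase 0 M))
  ξ-lam  : ∀ {M M'} → M ⟶ M' → lam M ⟶ lam M'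
  ξ-appl : ∀ {M M' N} → M ⟶ M' → app M N ⟶ app M' N
  ξ-appr : ∀ {M N N'} → N ⟶ N' → app M N ⟶ app M N'
  ξ-name : ∀ {α M M'} → M ⟶ M' → name α M ⟶ name α M'
  ξ-mu   : ∀ {M M'} → M ⟶ M' → mu M ⟶ mu M'

infix 4 _⟶*_
_⟶*_ : Term → Term → Set
_⟶*_ = Star _⟶_

data Redex : Term → Set where
  β-rdx  : ∀ {M N} → Redex (app (lam M) N)
  μ-rdx  : ∀ {M N} → Redex (app (mu M) N)
  μ'-rdx : ∀ {M N} → Redex (app N (mu M))
  ρ-rdx  : ∀ {β M} → Redex (name β (mu M))
  ε-rdx  : ∀ {M}   → Redex (mu (mu M))

data HasRedex : Term → Set where
  here   : ∀ {M} → Redex M → HasRedex M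
  in-lam : ∀ {M} → HasRedex M → HasRedex (lam M)
  in-appl : ∀ {M N} → HasRedex M → HasRedex (app M N)
  in-appr : ∀ {M N} → HasRedex N → HasRedex (app M N)
  in-name : ∀ {α M} → HasRedex M → HasRedex (name α M)
  in-mu  : ∀ {M} → HasRedex M → HasRedex (mu M)

Normal : Term → Set
Normal M = ¬ HasRedex M

WN : Term → Set
WN M = ∃ λ N → (M ⟶* N) × Normal N

data Ty : Set where
  atom : ℕ → Ty
  bot  : Ty
  _⇒_  : Ty → Ty → Ty

Ctx : Set
Ctx = ℕ → Ty

_∷ᶜ_ : Ty → Ctx → Ctx
(A ∷ᶜ Γ) zero    = A
(A ∷ᶜ Γ) (suc n) = Γ n

data _⊢_∶_∣_ : Ctx → Term → Ty → Ctx → Set where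
  t-var  : ∀ {Γ Θ x A} → Γ x ≡ A → Γ ⊢ var x ∶ A ∣ Θ
  t-lam  : ∀ {Γ Θ M A B} → (A ∷ᶜ Γ) ⊢ M ∶ B ∣ Θ → Γ ⊢ lam M ∶ A ⇒ B ∣ Θ
  t-app  : ∀ {Γ Θ M N A B} → Γ ⊢ M ∶ A ⇒ B ∣ Θ → Γ ⊢ N ∶ A ∣ Θ →
           Γ ⊢ app M N ∶ B ∣ Θ
  t-name : ∀ {Γ Θ M α} → Γ ⊢ M ∶ Θ α ∣ Θ → Γ ⊢ name α M ∶ bot ∣ Θ
  t-mu   : ∀ {Γ Θ M A} → Γ ⊢ M ∶ bot ∣ (A ∷ᶜ Θ) → Γ ⊢ mu M ∶ A ∣ Θ

Typable : Term → Set
Typable M = ∃ λ Γ → ∃ λ Θ → ∃ λ A → Γ ⊢ M ∶ A ∣ Θ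

-- Reduce M to a normal form N; then μα.M reduces to μα.N. If N is not itself
-- a μ-abstraction, μα.N is normal. If N = μβ.N', one ε-step gives μα.N'_β, and
-- this is normal: erasing the [β]-nodes of a normal term can only create a
-- redex when some [β]P has P a λ- or a μ-abstraction. The latter is a ρ-redex
-- of N, and the former is ruled out by typing, since β has type ⊥ in N'
-- (subject reduction transports the typing of μα.M to μα.N).

module Submission where

open import Defs
open import Data.Product using (_×_; _,_)
open import Data.Nat using (ℕ; zero; suc; pred; _≟_)
open import Data.Empty using (⊥-elim)
open import Data.Sum using (_⊎_; inj₁; inj₂) renaming (map to ⊎-map)
open import Function using (_∘_)
open import Relation.Nullary using (¬_; yes; no)
open import Relation.Binary.PropositionalEquality
  using (_≡_; _≢_; refl; sym; cong; trans; _≗_)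
open import Relation.Binary.Construct.Closure.ReflexiveTransitive
  using (ε; _◅_; _◅◅_; gmap)

retype : ∀ {Γ Θ M A B} → A ≡ B → Γ ⊢ M ∶ A ∣ Θ → Γ ⊢ M ∶ B ∣ Θ
retype refl d = d

ext-≗ : ∀ {Γ Δ B} {ρ : ℕ → ℕ} → Δ ∘ ρ ≗ Γ → (B ∷ᶜ Δ) ∘ ext ρ ≗ B ∷ᶜ Γ
ext-≗ h zero    = refl
ext-≗ h (suc x) = h x

renL-⊢ : ∀ {Γ Δ Θ M A} (ρ : ℕ → ℕ) → Δ ∘ ρ ≗ Γ →
         Γ ⊢ M ∶ A ∣ Θ → Δ ⊢ renL ρ M ∶ A ∣ Θ
renL-⊢ ρ h (t-var {x = x} e) = t-var (trans (h x) e)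
renL-⊢ ρ h (t-lam d)         = t-lam (renL-⊢ (ext ρ) (ext-≗ h) d)
renL-⊢ ρ h (t-app d e)       = t-app (renL-⊢ ρ h d) (renL-⊢ ρ h e)
renL-⊢ ρ h (t-name d)        = t-name (renL-⊢ ρ h d)
renL-⊢ ρ h (t-mu d)          = t-mu (renL-⊢ ρ h d)

renM-⊢ : ∀ {Γ Θ Θ' M A} (ρ : ℕ → ℕ) → Θ' ∘ ρ ≗ Θ →
         Γ ⊢ M ∶ A ∣ Θ → Γ ⊢ renM ρ M ∶ A ∣ Θ'
renM-⊢ ρ h (t-var e)          = t-var e
renM-⊢ ρ h (t-lam d)          = t-lam (renM-⊢ ρ h d)
renM-⊢ ρ h (t-app d e)        = t-app (renM-⊢ ρ h d) (renM-⊢ ρ h e)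
renM-⊢ ρ h (t-name {α = α} d) = t-name (retype (sym (h α)) (renM-⊢ ρ h d))
renM-⊢ ρ h (t-mu d)           = t-mu (renM-⊢ (ext ρ) (ext-≗ h) d)

extsL-⊢ : ∀ {Γ Δ Θ B} (σ : ℕ → Term) → (∀ x → Δ ⊢ σ x ∶ Γ x ∣ Θ) →
          ∀ x → (B ∷ᶜ Δ) ⊢ extsL σ x ∶ (B ∷ᶜ Γ) x ∣ Θ
extsL-⊢ σ h zero    = t-var refl
extsL-⊢ σ h (suc x) = renL-⊢ suc (λ _ → refl) (h x)

subL-⊢ : ∀ {Γ Δ Θ M A} (σ : ℕ → Term) → (∀ x → Δ ⊢ σ x ∶ Γ x ∣ Θ) →
         Γ ⊢ M ∶ A ∣ Θ → Δ ⊢ subL σ M ∶ A ∣ Θ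
subL-⊢ σ h (t-var {x = x} e) = retype e (h x)
subL-⊢ σ h (t-lam d)         = t-lam (subL-⊢ (extsL σ) (extsL-⊢ σ h) d)
subL-⊢ σ h (t-app d e)       = t-app (subL-⊢ σ h d) (subL-⊢ σ h e)
subL-⊢ σ h (t-name d)        = t-name (subL-⊢ σ h d)
subL-⊢ σ h (t-mu d)          = t-mu (subL-⊢ _ (renM-⊢ suc (λ _ → refl) ∘ h) d)

sub0-⊢ : ∀ {Γ Θ N B} → Γ ⊢ N ∶ B ∣ Θ → ∀ x → Γ ⊢ sub0 N x ∶ (B ∷ᶜ Γ) x ∣ Θ
sub0-⊢ d zero    = d
sub0-⊢ d (suc x) = t-var refl

AgreeExcept : ℕ → Ctx → Ctx → Set
AgreeExcept k Θ Θ' = ∀ α → α ≢ k → Θ' α ≡ Θ α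

AgreeExcept-zero : ∀ {A B Θ} → AgreeExcept 0 (A ∷ᶜ Θ) (B ∷ᶜ Θ)
AgreeExcept-zero zero    0≢0 = ⊥-elim (0≢0 refl)
AgreeExcept-zero (suc α) _   = refl

AgreeExcept-∷ᶜ : ∀ {k Θ Θ' D} → AgreeExcept k Θ Θ' →
                 AgreeExcept (suc k) (D ∷ᶜ Θ) (D ∷ᶜ Θ')
AgreeExcept-∷ᶜ h zero    _  = refl
AgreeExcept-∷ᶜ h (suc α) ne = h α (ne ∘ cong suc)

structR-⊢ : ∀ {Γ Θ Θ' M A B} k N → Θ k ≡ B ⇒ Θ' k → AgreeExcept k Θ Θ' →
            Γ ⊢ N ∶ B ∣ Θ' → Γ ⊢ M ∶ A ∣ Θ → Γ ⊢ structR k N M ∶ A ∣ Θ'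
structR-⊢ k N e h dN (t-var x)   = t-var x
structR-⊢ k N e h dN (t-lam d)   =
  t-lam (structR-⊢ k (renL suc N) e h (renL-⊢ suc (λ _ → refl) dN) d)
structR-⊢ k N e h dN (t-app d d') =
  t-app (structR-⊢ k N e h dN d) (structR-⊢ k N e h dN d')
structR-⊢ k N e h dN (t-name {α = β} d) with β ≟ k
... | yes refl = t-name (t-app (retype e (structR-⊢ k N e h dN d)) dN)
... | no β≢k   = t-name (retype (sym (h β β≢k)) (structR-⊢ k N e h dN d))
structR-⊢ k N e h dN (t-mu d)    =
  t-mu (structR-⊢ (suc k) (renM suc N) e (AgreeExcept-∷ᶜ h)
                  (renM-⊢ suc (λ _ → refl) dN) d)

structL-⊢ : ∀ {Γ Θ Θ' M A} k N → AgreeExcept k Θ Θ' →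
            Γ ⊢ N ∶ Θ k ⇒ Θ' k ∣ Θ' → Γ ⊢ M ∶ A ∣ Θ → Γ ⊢ structL k N M ∶ A ∣ Θ'
structL-⊢ k N h dN (t-var x)    = t-var x
structL-⊢ k N h dN (t-lam d)    =
  t-lam (structL-⊢ k (renL suc N) h (renL-⊢ suc (λ _ → refl) dN) d)
structL-⊢ k N h dN (t-app d d') =
  t-app (structL-⊢ k N h dN d) (structL-⊢ k N h dN d')
structL-⊢ k N h dN (t-name {α = β} d) with β ≟ k
... | yes refl = t-name (t-app dN (structL-⊢ k N h dN d))
... | no β≢k   = t-name (retype (sym (h β β≢k)) (structL-⊢ k N h dN d))
structL-⊢ k N h dN (t-mu d)     =
  t-mu (structL-⊢ (suc k) (renM suc N) (AgreeExcept-∷ᶜ h)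
                  (renM-⊢ suc (λ _ → refl) dN) d)

erase-⊢ : ∀ {Γ Θ Θ' M A} k → Θ k ≡ bot → AgreeExcept k Θ Θ' →
          Γ ⊢ M ∶ A ∣ Θ → Γ ⊢ erase k M ∶ A ∣ Θ'
erase-⊢ k e h (t-var x)    = t-var x
erase-⊢ k e h (t-lam d)    = t-lam (erase-⊢ k e h d)
erase-⊢ k e h (t-app d d') = t-app (erase-⊢ k e h d) (erase-⊢ k e h d')
erase-⊢ k e h (t-name {α = β} d) with β ≟ k
... | yes refl = retype e (erase-⊢ k e h d)
... | no β≢k   = t-name (retype (sym (h β β≢k)) (erase-⊢ k e h d))
erase-⊢ k e h (t-mu d)     = t-mu (erase-⊢ (suc k) e (AgreeExcept-∷ᶜ h) d)

rhoRen-≗ : ∀ Θ β → Θ ∘ rhoRen β ≗ Θ β ∷ᶜ Θ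
rhoRen-≗ Θ β zero    = refl
rhoRen-≗ Θ β (suc α) = refl

pred-≗ : ∀ A Θ → (A ∷ᶜ Θ) ∘ pred ≗ A ∷ᶜ (A ∷ᶜ Θ)
pred-≗ A Θ zero    = refl
pred-≗ A Θ (suc α) = refl

⟶-⊢ : ∀ {Γ Θ M M' A} → Γ ⊢ M ∶ A ∣ Θ → M ⟶ M' → Γ ⊢ M' ∶ A ∣ Θ
⟶-⊢ (t-app (t-lam d) e) β-red  = subL-⊢ _ (sub0-⊢ e) d
⟶-⊢ (t-app (t-mu d) e)  μ-red  =
  t-mu (structR-⊢ 0 _ refl AgreeExcept-zero (renM-⊢ suc (λ _ → refl) e) d)
⟶-⊢ (t-app e (t-mu d))  μ'-red =
  t-mu (structL-⊢ 0 _ AgreeExcept-zero (renM-⊢ suc (λ _ → refl) e) d)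
⟶-⊢ {Θ = Θ} (t-name {α = β} (t-mu d)) ρ-red = renM-⊢ (rhoRen β) (rhoRen-≗ Θ β) d
⟶-⊢ {Θ = Θ} {A = A} (t-mu (t-mu d)) ε-red =
  t-mu (renM-⊢ pred (pred-≗ A Θ) (erase-⊢ 0 refl AgreeExcept-zero d))
⟶-⊢ (t-lam d)   (ξ-lam r)  = t-lam (⟶-⊢ d r)
⟶-⊢ (t-app d e) (ξ-appl r) = t-app (⟶-⊢ d r) e
⟶-⊢ (t-app d e) (ξ-appr r) = t-app d (⟶-⊢ e r)
⟶-⊢ (t-name d)  (ξ-name r) = t-name (⟶-⊢ d r)
⟶-⊢ (t-mu d)    (ξ-mu r)   = t-mu (⟶-⊢ d r)

⟶*-⊢ : ∀ {Γ Θ M M' A} → Γ ⊢ M ∶ A ∣ Θ → M ⟶* M' → Γ ⊢ M' ∶ A ∣ Θ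
⟶*-⊢ d ε        = d
⟶*-⊢ d (r ◅ rs) = ⟶*-⊢ (⟶-⊢ d r) rs

data IsLam : Term → Set where
  lam : ∀ {M} → IsLam (lam M)

data IsMu : Term → Set where
  mu : ∀ {M} → IsMu (mu M)

app-redex-shape : ∀ {M N} → Redex (app M N) → IsLam M ⊎ IsMu M ⊎ IsMu N
app-redex-shape β-rdx  = inj₁ lam
app-redex-shape μ-rdx  = inj₂ (inj₁ mu)
app-redex-shape μ'-rdx = inj₂ (inj₂ mu)

shape-app-redex : ∀ {M N} → IsLam M ⊎ IsMu M ⊎ IsMu N → Redex (app M N)
shape-app-redex (inj₁ lam)        = β-rdx
shape-app-redex (inj₂ (inj₁ mu))  = μ-rdx
shape-app-redex (inj₂ (inj₂ mu))  = μ'-rdx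

name-redex-shape : ∀ {β M} → Redex (name β M) → IsMu M
name-redex-shape ρ-rdx = mu

shape-name-redex : ∀ {β M} → IsMu M → Redex (name β M)
shape-name-redex mu = ρ-rdx

mu-redex-shape : ∀ {M} → Redex (mu M) → IsMu M
mu-redex-shape ε-rdx = mu

shape-mu-redex : ∀ {M} → IsMu M → Redex (mu M)
shape-mu-redex mu = ε-rdx

renM-reflects-lam : ∀ ρ M → IsLam (renM ρ M) → IsLam M
renM-reflects-lam ρ (lam M)    _ = lam
renM-reflects-lam ρ (var x)    ()
renM-reflects-lam ρ (app M N)  ()
renM-reflects-lam ρ (name α M) ()
renM-reflects-lam ρ (mu M)     ()

renM-reflects-mu : ∀ ρ M → IsMu (renM ρ M) → IsMu M
renM-reflects-mu ρ (mu M)     _ = mu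
renM-reflects-mu ρ (var x)    ()
renM-reflects-mu ρ (lam M)    ()
renM-reflects-mu ρ (app M N)  ()
renM-reflects-mu ρ (name α M) ()

renM-normal : ∀ ρ M → Normal M → Normal (renM ρ M)
renM-normal ρ (var x)    nf (here ())
renM-normal ρ (lam M)    nf (here ())
renM-normal ρ (lam M)    nf (in-lam h)  = renM-normal ρ M (nf ∘ in-lam) h
renM-normal ρ (app M N)  nf (here r)    =
  nf (here (shape-app-redex (⊎-map (renM-reflects-lam ρ M)
    (⊎-map (renM-reflects-mu ρ M) (renM-reflects-mu ρ N)) (app-redex-shape r))))
renM-normal ρ (app M N)  nf (in-appl h) = renM-normal ρ M (nf ∘ in-appl) h
renM-normal ρ (app M N)  nf (in-appr h) = renM-normal ρ N (nf ∘ in-appr) h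
renM-normal ρ (name β M) nf (here r)    =
  nf (here (shape-name-redex (renM-reflects-mu ρ M (name-redex-shape r))))
renM-normal ρ (name β M) nf (in-name h) = renM-normal ρ M (nf ∘ in-name) h
renM-normal ρ (mu M)     nf (here r)    =
  nf (here (shape-mu-redex (renM-reflects-mu (ext ρ) M (mu-redex-shape r))))
renM-normal ρ (mu M)     nf (in-mu h)   = renM-normal (ext ρ) M (nf ∘ in-mu) h

lam-not-bot : ∀ {Γ Θ M} → Γ ⊢ M ∶ bot ∣ Θ → ¬ IsLam M
lam-not-bot () lam

erase-reflects-lam : ∀ {Γ Θ M A} k → Θ k ≡ bot → Γ ⊢ M ∶ A ∣ Θ →
                     IsLam (erase k M) → IsLam M
erase-reflects-lam k e (t-lam d) _ = lam
erase-reflects-lam k e (t-name {α = β} d) l with β ≟ k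
erase-reflects-lam k e (t-name d) l | yes refl =
  ⊥-elim (lam-not-bot (retype e d) (erase-reflects-lam k e d l))
erase-reflects-lam k e (t-name d) () | no _

erase-reflects-mu : ∀ k M → Normal M → IsMu (erase k M) → IsMu M
erase-reflects-mu k (mu M) nf _ = mu
erase-reflects-mu k (name β M) nf m with β ≟ k
... | yes refl =
  ⊥-elim (nf (here (shape-name-redex (erase-reflects-mu k M (nf ∘ in-name) m))))
erase-reflects-mu k (name β M) nf () | no _

erase-normal : ∀ {Γ Θ M A} k → Θ k ≡ bot → Γ ⊢ M ∶ A ∣ Θ →
               Normal M → Normal (erase k M)
erase-normal k e (t-var x)   nf (here ())
erase-normal k e (t-lam d)   nf (here ())
erase-normal k e (t-lam d)   nf (in-lam h) = erase-normal k e d (nf ∘ in-lam) h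
erase-normal k e (t-app {M = M} {N} dM dN) nf (here r) =
  nf (here (shape-app-redex (⊎-map (erase-reflects-lam k e dM)
    (⊎-map (erase-reflects-mu k M (nf ∘ in-appl))
           (erase-reflects-mu k N (nf ∘ in-appr))) (app-redex-shape r))))
erase-normal k e (t-app dM dN) nf (in-appl h) = erase-normal k e dM (nf ∘ in-appl) h
erase-normal k e (t-app dM dN) nf (in-appr h) = erase-normal k e dN (nf ∘ in-appr) h
erase-normal k e (t-name {α = β} d) nf h with β ≟ k
... | yes refl = erase-normal k e d (nf ∘ in-name) h
erase-normal k e (t-name {M = M} d) nf (here r) | no _ =
  nf (here (shape-name-redex (erase-reflects-mu k M (nf ∘ in-name) (name-redex-shape r))))
erase-normal k e (t-name d) nf (in-name h) | no _ = erase-normal k e d (nf ∘ in-name) h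
erase-normal k e (t-mu {M = M} d) nf (here r) =
  nf (here (shape-mu-redex (erase-reflects-mu (suc k) M (nf ∘ in-mu) (mu-redex-shape r))))
erase-normal k e (t-mu d) nf (in-mu h) = erase-normal (suc k) e d (nf ∘ in-mu) h

mu-normal : ∀ {N} → Normal N → ¬ IsMu N → Normal (mu N)
mu-normal nf notMu (here ε-rdx) = notMu mu
mu-normal nf notMu (in-mu h)    = nf h

mu-normal-WN : ∀ {Γ Θ A} N → Γ ⊢ N ∶ bot ∣ (A ∷ᶜ Θ) → Normal N → WN (mu N)
mu-normal-WN (mu N) (t-mu d) nf =
  _ , ε-red ◅ ε , mu-normal (renM-normal pred _ (erase-normal 0 refl d nfN)) not-mu
  where
  nfN : Normal N
  nfN = nf ∘ in-mu
  not-mu : ¬ IsMu (renM pred (erase 0 N))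
  not-mu = nf ∘ here ∘ shape-mu-redex ∘ erase-reflects-mu 0 N nfN
             ∘ renM-reflects-mu pred (erase 0 N)
mu-normal-WN (var x)    _ nf = _ , ε , mu-normal nf λ ()
mu-normal-WN (lam N)    _ nf = _ , ε , mu-normal nf λ ()
mu-normal-WN (app N N') _ nf = _ , ε , mu-normal nf λ ()
mu-normal-WN (name α N) _ nf = _ , ε , mu-normal nf λ ()

-- The hypothesis Typable M is implied by Typable (mu M), hence unused.
lemma5p10 : (M : Term) → WN M → Typable M → Typable (mu M) →
            WN (mu M) × Typable (mu M)
lemma5p10 M (N , M⟶*N , nf) _ ⊢μM@(_ , _ , _ , t-mu ⊢M)
  with mu-normal-WN N (⟶*-⊢ ⊢M M⟶*N) nf
... | P , μN⟶*P , nfP = (P , gmap mu ξ-mu M⟶*N ◅◅ μN⟶*P , nfP) , ⊢μM
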